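{- Let $G$ be a graph with a pendant vertex $u$ adjacent to a vertex $v$ with $d_v\geq 3$, and let $w\neq u$ be a neighbor of $v$. Let $\Gamma$ be the graph obtained from $G-e_{vw}$ (the graph $G$ with the edge $vw$ deleted) and a disjoint path $P_2=x\sim y$ by adding the edge $wy$. Then $m_{L(G)}(1)=m_{L(\Gamma)}(1)$.
   Context: Graphs are finite, simple and undirected. $d_v$ is the degree of $v$. $L(G)=D(G)-A(G)$ is the Laplacian matrix, and $m_{L(G)}(1)$ is the multiplicity of $1$ as an eigenvalue of $L(G)$. A pendant vertex is a vertex of degree $1$. -}

module Defs where

open import Data.Bool using (Bool; true; false; _∧_; _∨_; not; if_then_else_)
open import Data.Bool.Properties using (∧-comm; ∨-comm)
open import Data.Nat using (ℕ; zero; suc; _+_)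
open import Data.Fin using (Fin; zero; suc)
open import Data.Fin.Properties using (_≟_)
open import Data.Rational using (ℚ; 0ℚ; 1ℚ; -_) renaming (_+_ to _+ℚ_; _*_ to _*ℚ_; _-_ to _-ℚ_)
import Data.Rational as ℚ
open import Data.Integer using (+_)
open import Data.Product using (Σ; _×_; _,_)
open import Relation.Nullary using (¬_)
open import Relation.Nullary.Decidable using (⌊_⌋)
open import Relation.Binary.PropositionalEquality using (_≡_; refl; cong₂; trans)

record Graph (n : ℕ) : Set where
  field
    adj     : Fin n → Fin n → Bool
    adj-sym : ∀ i j → adj i j ≡ adj j i
    irrefl  : ∀ i → adj i i ≡ false
open Graph public

sumℕ : ∀ {n} → (Fin n → ℕ) → ℕ
sumℕ {zero}  f = 0
sumℕ {suc n} f = f zero + sumℕ (λ i → f (suc i))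

sumℚ : ∀ {n} → (Fin n → ℚ) → ℚ
sumℚ {zero}  f = 0ℚ
sumℚ {suc n} f = f zero +ℚ sumℚ (λ i → f (suc i))

deg : ∀ {n} → Graph n → Fin n → ℕ
deg G v = sumℕ (λ j → if adj G v j then 1 else 0)

Laplacian : ∀ {n} → Graph n → Fin n → Fin n → ℚ
Laplacian G i j =
  if ⌊ i ≟ j ⌋ then (+ deg G i) ℚ./ 1
  else (if adj G i j then - 1ℚ else 0ℚ)

-- L(G) is real symmetric, so algebraic multiplicity = geometric multiplicity
-- = dim ker (L(G) - I); as L(G) is rational this dimension may be computed over ℚ.
Vector : ℕ → Set
Vector n = Fin n → ℚ

In1Eigenspace : ∀ {n} → (Fin n → Fin n → ℚ) → Vector n → Set
In1Eigenspace M x = ∀ i → sumℚ (λ j → M i j *ℚ x j) ≡ x i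

LinIndep : ∀ {n k} → (Fin k → Vector n) → Set
LinIndep {n} {k} vs =
  (c : Fin k → ℚ) → (∀ i → sumℚ (λ t → c t *ℚ vs t i) ≡ 0ℚ) → ∀ t → c t ≡ 0ℚ

Mult1 : ∀ {n} → (Fin n → Fin n → ℚ) → ℕ → Set
Mult1 {n} M m =
  Σ (Fin m → Vector n) (λ vs → (∀ t → In1Eigenspace M (vs t)) × LinIndep vs)
  × ((vs : Fin (suc m) → Vector n) → (∀ t → In1Eigenspace M (vs t)) → ¬ LinIndep vs)

-- The construction of Γ from G, v, w: vertices of Γ are Fin (2 + n) with
-- x = zero, y = suc zero, and old vertex i ↦ suc (suc i).
-- Γ = (G - vw) ∪ (path x ~ y) + edge wy.
isVW : ∀ {n} → Fin n → Fin n → Fin n → Fin n → Bool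
isVW v w i j = (⌊ i ≟ v ⌋ ∧ ⌊ j ≟ w ⌋) ∨ (⌊ i ≟ w ⌋ ∧ ⌊ j ≟ v ⌋)

isVW-sym : ∀ {n} (v w i j : Fin n) → isVW v w i j ≡ isVW v w j i
isVW-sym v w i j =
  trans (∨-comm (⌊ i ≟ v ⌋ ∧ ⌊ j ≟ w ⌋) (⌊ i ≟ w ⌋ ∧ ⌊ j ≟ v ⌋))
        (cong₂ _∨_ (∧-comm ⌊ i ≟ w ⌋ ⌊ j ≟ v ⌋) (∧-comm ⌊ i ≟ v ⌋ ⌊ j ≟ w ⌋))

adjΓ : ∀ {n} → Graph n → Fin n → Fin n → Fin (2 + n) → Fin (2 + n) → Bool
adjΓ G v w zero zero = false
adjΓ G v w zero (suc zero) = true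
adjΓ G v w zero (suc (suc j)) = false
adjΓ G v w (suc zero) zero = true
adjΓ G v w (suc zero) (suc zero) = false
adjΓ G v w (suc zero) (suc (suc j)) = ⌊ j ≟ w ⌋
adjΓ G v w (suc (suc i)) zero = false
adjΓ G v w (suc (suc i)) (suc zero) = ⌊ i ≟ w ⌋
adjΓ G v w (suc (suc i)) (suc (suc j)) = adj G i j ∧ not (isVW v w i j)

adjΓ-sym : ∀ {n} (G : Graph n) v w i j → adjΓ G v w i j ≡ adjΓ G v w j i
adjΓ-sym G v w zero zero = refl
adjΓ-sym G v w zero (suc zero) = refl
adjΓ-sym G v w zero (suc (suc j)) = refl
adjΓ-sym G v w (suc zero) zero = refl
adjΓ-sym G v w (suc zero) (suc zero) = refl
adjΓ-sym G v w (suc zero) (suc (suc j)) = refl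
adjΓ-sym G v w (suc (suc i)) zero = refl
adjΓ-sym G v w (suc (suc i)) (suc zero) = refl
adjΓ-sym G v w (suc (suc i)) (suc (suc j)) =
  cong₂ (λ a b → a ∧ not b) (adj-sym G i j) (isVW-sym v w i j)

adjΓ-irrefl : ∀ {n} (G : Graph n) v w i → adjΓ G v w i i ≡ false
adjΓ-irrefl G v w zero = refl
adjΓ-irrefl G v w (suc zero) = refl
adjΓ-irrefl G v w (suc (suc i)) = cong₂ (λ a b → a ∧ not b) (irrefl G i) refl

Γ : ∀ {n} → Graph n → Fin n → Fin n → Graph (2 + n)
Γ G v w = record
  { adj = adjΓ G v w ; adj-sym = adjΓ-sym G v w ; irrefl = adjΓ-irrefl G v w }

-- A 1-eigenvector z of L(G) vanishes at v, because the row of the leaf u reads z u − z v = z u.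
-- Extend z to Γ by z x = − z w and z y = 0, and raise the value at u by z w: deleting vw takes
-- the term z v − z w = − z w out of row v, which the raised value at u puts back, and takes
-- z w − z v = z w out of row w, which the new neighbour y puts back. Conversely every
-- 1-eigenvector of Γ has z y = 0 (x is a leaf at y) and then z x = − z w (row y), so this linear
-- map is a bijection between the two eigenspaces for 1, which therefore have equal dimension.
{-# OPTIONS --safe #-}
module Submission where

open import Defs
open import Data.Nat using (ℕ; _≥_)
open import Data.Fin using (Fin)
open import Data.Bool using (true)
open import Function.Bundles using (_⇔_)
open import Relation.Binary.PropositionalEquality using (_≡_; _≢_)

open import Algebra.Bundles using (CommutativeMonoid)
open import Data.Bool using (Bool; false; if_then_else_; _∧_; not)
open import Data.Bool.Properties using (∧-identityʳ; ∨-identityʳ)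
open import Data.Empty using (⊥-elim)
open import Data.Fin using (zero; suc)
open import Data.Fin.Properties using (_≟_)
import Data.Integer as ℤ
import Data.Integer.Properties as ℤ
open import Data.Nat using (_≤_; s≤s) renaming (_+_ to _+ℕ_)
import Data.Nat.Properties as ℕ
open import Data.Nat.Coprimality using (1-coprimeTo) renaming (sym to coprime-sym)
open import Data.Product using (_,_)
open import Data.Rational using (ℚ; mkℚ; 0ℚ; 1ℚ; -_; _+_; _*_; _-_; _/_)
open import Data.Rational.Properties
  using ( +-identityˡ; +-identityʳ; +-inverseʳ; *-comm; *-zeroˡ; *-zeroʳ; *-identityˡ; *-identityʳ
        ; *-distribˡ-+; neg-distrib-+; neg-distribˡ-*; neg-distribʳ-*; +-0-commutativeMonoid
        ; normalize-coprime; /-cong )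
open import Algebra.Properties.CommutativeSemigroup
  (CommutativeMonoid.commutativeSemigroup +-0-commutativeMonoid) using (interchange)
open import Data.Rational.Solver using (module +-*-Solver)
open +-*-Solver using (solve; _:=_; _:+_; :-_; _:-_; con)
open import Function.Base using (_∘_; const)
open import Function.Bundles using (mk⇔; Equivalence)
open import Relation.Binary.PropositionalEquality
  using (refl; sym; trans; cong; cong₂; subst; subst₂; _≗_; module ≡-Reasoning)
open import Relation.Nullary using (¬_; Dec; yes; no)
open import Relation.Nullary.Decidable using (⌊_⌋; isYes≗does; dec-true; dec-false; ⌊⌋-map′)

infix 5 _when_
_when_ : ℚ → Bool → ℚ
x when b = if b then x else 0ℚ

when-cong : ∀ {b x y} → (b ≡ true → x ≡ y) → x when b ≡ y when b
when-cong {false} _   = refl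
when-cong {true}  x≡y = x≡y refl

0ℚ-when : ∀ b → (0ℚ when b) ≡ 0ℚ
0ℚ-when false = refl
0ℚ-when true  = refl

when-+ : ∀ b x y → (x when b) + (y when b) ≡ (x + y when b)
when-+ false x y = +-identityˡ 0ℚ
when-+ true  x y = refl

⌊≟⌋-refl : ∀ {n} (i : Fin n) → ⌊ i ≟ i ⌋ ≡ true
⌊≟⌋-refl i = trans (isYes≗does (i ≟ i)) (dec-true (i ≟ i) refl)

⌊≟⌋-≢ : ∀ {n} {i j : Fin n} → i ≢ j → ⌊ i ≟ j ⌋ ≡ false
⌊≟⌋-≢ {i = i} {j} i≢j = trans (isYes≗does (i ≟ j)) (dec-false (i ≟ j) i≢j)

⌊≟⌋-sym : ∀ {n} (i j : Fin n) → ⌊ i ≟ j ⌋ ≡ ⌊ j ≟ i ⌋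
⌊≟⌋-sym i j with i ≟ j
... | yes refl = sym (⌊≟⌋-refl i)
... | no i≢j   = sym (⌊≟⌋-≢ (λ j≡i → i≢j (sym j≡i)))

⌊≟⌋-suc : ∀ {n} (i j : Fin n) → ⌊ suc i ≟ suc j ⌋ ≡ ⌊ i ≟ j ⌋
⌊≟⌋-suc i j = ⌊⌋-map′ (cong suc) _ (i ≟ j)

⌊≟⌋⇒≡ : ∀ {n} {i j : Fin n} → ⌊ i ≟ j ⌋ ≡ true → i ≡ j
⌊≟⌋⇒≡ {i = i} {j} eq with i ≟ j | eq
... | yes i≡j | _  = i≡j
... | no _    | ()

Fin-split : ∀ {n} (P : Fin n → Set) k → P k → (∀ {i} → i ≢ k → P i) → ∀ i → P i
Fin-split P k pk p≢ i with i ≟ k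
... | yes refl = pk
... | no i≢k   = p≢ i≢k

sumℚ-cong : ∀ {n} {f g : Fin n → ℚ} → f ≗ g → sumℚ f ≡ sumℚ g
sumℚ-cong {ℕ.zero}  f≗g = refl
sumℚ-cong {ℕ.suc n} f≗g = cong₂ _+_ (f≗g zero) (sumℚ-cong (f≗g ∘ suc))

sumℚ-zero : ∀ n → sumℚ {n} (const 0ℚ) ≡ 0ℚ
sumℚ-zero ℕ.zero    = refl
sumℚ-zero (ℕ.suc n) = trans (+-identityˡ _) (sumℚ-zero n)

sumℚ-+ : ∀ {n} (f g : Fin n → ℚ) → sumℚ (λ j → f j + g j) ≡ sumℚ f + sumℚ g
sumℚ-+ {ℕ.zero}  f g = refl
sumℚ-+ {ℕ.suc n} f g =
  trans (cong (f zero + g zero +_) (sumℚ-+ (f ∘ suc) (g ∘ suc)))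
        (interchange (f zero) (g zero) (sumℚ (f ∘ suc)) (sumℚ (g ∘ suc)))

sumℚ-neg : ∀ {n} (f : Fin n → ℚ) → sumℚ (λ j → - f j) ≡ - sumℚ f
sumℚ-neg {ℕ.zero}  f = refl
sumℚ-neg {ℕ.suc n} f =
  trans (cong (- f zero +_) (sumℚ-neg (f ∘ suc))) (sym (neg-distrib-+ (f zero) (sumℚ (f ∘ suc))))

sumℚ-*ˡ : ∀ {n} (c : ℚ) (f : Fin n → ℚ) → sumℚ (λ j → c * f j) ≡ c * sumℚ f
sumℚ-*ˡ {ℕ.zero}  c f = sym (*-zeroʳ c)
sumℚ-*ˡ {ℕ.suc n} c f =
  trans (cong (c * f zero +_) (sumℚ-*ˡ c (f ∘ suc))) (sym (*-distribˡ-+ c (f zero) (sumℚ (f ∘ suc))))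

sumℚ-δ : ∀ {n} (k : Fin n) (f : Fin n → ℚ) → sumℚ (λ j → f j when ⌊ k ≟ j ⌋) ≡ f k
sumℚ-δ {ℕ.suc n} zero    f = trans (cong (f zero +_) (sumℚ-zero n)) (+-identityʳ (f zero))
sumℚ-δ           (suc k) f = trans (+-identityˡ _) (trans
  (sumℚ-cong (λ j → cong (f (suc j) when_) (⌊≟⌋-suc k j)))
  (sumℚ-δ k (f ∘ suc)))

sumℚ-δ′ : ∀ {n} (k : Fin n) (f : Fin n → ℚ) → sumℚ (λ j → f j when ⌊ j ≟ k ⌋) ≡ f k
sumℚ-δ′ k f = trans (sumℚ-cong (λ j → cong (f j when_) (⌊≟⌋-sym j k))) (sumℚ-δ k f)

sumℚ-when-∧-not : ∀ {n} (b : Fin n → Bool) (f : Fin n → ℚ) {k} → b k ≡ true →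
  sumℚ (λ j → f j when b j ∧ not ⌊ j ≟ k ⌋) ≡ sumℚ (λ j → f j when b j) - f k
sumℚ-when-∧-not b f {k} bk = begin
  sumℚ (λ j → f j when b j ∧ not ⌊ j ≟ k ⌋)                  ≡⟨ sumℚ-cong drop-k ⟩
  sumℚ (λ j → (f j when b j) + - (f j when ⌊ j ≟ k ⌋))        ≡⟨ sumℚ-+ (λ j → f j when b j) _ ⟩
  sumℚ (λ j → f j when b j) + sumℚ (λ j → - (f j when ⌊ j ≟ k ⌋))
    ≡⟨ cong (sumℚ (λ j → f j when b j) +_)
            (trans (sumℚ-neg (λ j → f j when ⌊ j ≟ k ⌋)) (cong -_ (sumℚ-δ′ k f))) ⟩
  sumℚ (λ j → f j when b j) - f k                              ∎
  where
  open ≡-Reasoning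
  drop-k : ∀ j → (f j when b j ∧ not ⌊ j ≟ k ⌋) ≡ (f j when b j) + - (f j when ⌊ j ≟ k ⌋)
  drop-k j with j ≟ k
  ... | yes refl rewrite bk = sym (+-inverseʳ (f j))
  ... | no _ = trans (cong (f j when_) (∧-identityʳ (b j))) (sym (+-identityʳ _))

ℕ→ℚ : ℕ → ℚ
ℕ→ℚ k = ℤ.+ k / 1

ℕ→ℚ-+ : ∀ a b → ℕ→ℚ (a +ℕ b) ≡ ℕ→ℚ a + ℕ→ℚ b
ℕ→ℚ-+ a b = begin
  ℤ.+ (a +ℕ b) / 1                          ≡⟨ /-cong (sym numerator) refl ⟩
  (ℤ.+ a ℤ.* ℤ.+ 1 ℤ.+ ℤ.+ b ℤ.* ℤ.+ 1) / 1  ≡⟨ cong₂ _+_ (sym (as-mkℚ a)) (sym (as-mkℚ b)) ⟩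
  ℕ→ℚ a + ℕ→ℚ b                             ∎
  where
  open ≡-Reasoning
  as-mkℚ : ∀ k → ℕ→ℚ k ≡ mkℚ (ℤ.+ k) 0 (coprime-sym (1-coprimeTo k))
  as-mkℚ k = normalize-coprime (coprime-sym (1-coprimeTo k))
  numerator : ℤ.+ a ℤ.* ℤ.+ 1 ℤ.+ ℤ.+ b ℤ.* ℤ.+ 1 ≡ ℤ.+ (a +ℕ b)
  numerator = trans (cong₂ ℤ._+_ (ℤ.*-identityʳ (ℤ.+ a)) (ℤ.*-identityʳ (ℤ.+ b))) (sym (ℤ.pos-+ a b))

sumℕ→ℚ : ∀ {n} (f : Fin n → ℕ) → ℕ→ℚ (sumℕ f) ≡ sumℚ (ℕ→ℚ ∘ f)
sumℕ→ℚ {ℕ.zero}  f = refl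
sumℕ→ℚ {ℕ.suc n} f = trans (ℕ→ℚ-+ (f zero) _) (cong (ℕ→ℚ (f zero) +_) (sumℕ→ℚ (f ∘ suc)))

term≤sumℕ : ∀ {n} (f : Fin n → ℕ) a → f a ≤ sumℕ f
term≤sumℕ f zero    = ℕ.m≤m+n (f zero) _
term≤sumℕ f (suc a) = ℕ.≤-trans (term≤sumℕ (f ∘ suc) a) (ℕ.m≤n+m _ (f zero))

pair≤sumℕ : ∀ {n} (f : Fin n → ℕ) {a b} → a ≢ b → f a +ℕ f b ≤ sumℕ f
pair≤sumℕ f {zero}  {zero}  a≢b = ⊥-elim (a≢b refl)
pair≤sumℕ f {zero}  {suc b} a≢b = ℕ.+-monoʳ-≤ (f zero) (term≤sumℕ (f ∘ suc) b)
pair≤sumℕ f {suc a} {zero}  a≢b =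
  subst (_≤ sumℕ f) (ℕ.+-comm (f zero) (f (suc a))) (ℕ.+-monoʳ-≤ (f zero) (term≤sumℕ (f ∘ suc) a))
pair≤sumℕ f {suc a} {suc b} a≢b =
  ℕ.≤-trans (pair≤sumℕ (f ∘ suc) (a≢b ∘ cong suc)) (ℕ.m≤n+m _ (f zero))

adj⇒≢ : ∀ {n} (G : Graph n) {i j} → adj G i j ≡ true → i ≢ j
adj⇒≢ G {i} i~j refl with trans (sym i~j) (irrefl G i)
... | ()

deg≡1⇒unique-neighbour : ∀ {n} (G : Graph n) {u v j} →
  deg G u ≡ 1 → adj G u v ≡ true → adj G u j ≡ true → j ≡ v
deg≡1⇒unique-neighbour G {u} {v} {j} deg≡1 u~v u~j with j ≟ v
... | yes j≡v = j≡v
... | no j≢v  = ⊥-elim (2≰1 (subst (2 ≤_) deg≡1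
      (subst₂ (λ a b → ind a +ℕ ind b ≤ deg G u) u~j u~v (pair≤sumℕ (ind ∘ adj G u) j≢v))))
  where
  ind : Bool → ℕ
  ind b = if b then 1 else 0
  2≰1 : ¬ (2 ≤ 1)
  2≰1 (s≤s ())

record Leaf {n} (G : Graph n) (u v : Fin n) : Set where
  constructor leaf
  field neighbours : ∀ j → adj G u j ≡ ⌊ v ≟ j ⌋
open Leaf public

deg≡1⇒Leaf : ∀ {n} (G : Graph n) {u v} → deg G u ≡ 1 → adj G u v ≡ true → Leaf G u v
deg≡1⇒Leaf G {u} {v} deg≡1 u~v = leaf neighbours-u
  where
  neighbours-u : ∀ j → adj G u j ≡ ⌊ v ≟ j ⌋
  neighbours-u j with v ≟ j | adj G u j in u~j
  ... | yes refl | _     = trans (sym u~j) u~v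
  ... | no _     | false = refl
  ... | no v≢j   | true  = ⊥-elim (v≢j (sym (deg≡1⇒unique-neighbour G deg≡1 u~v u~j)))

Leaf⇒neighbour : ∀ {n} (G : Graph n) {u v i} → Leaf G u v → adj G i u ≡ true → i ≡ v
Leaf⇒neighbour G {u} {v} {i} u-leaf i~u =
  sym (⌊≟⌋⇒≡ (trans (sym (neighbours u-leaf i)) (trans (adj-sym G u i) i~u)))

laplace : ∀ {n} → Graph n → Vector n → Vector n
laplace G z i = sumℚ (λ j → z i - z j when adj G i j)

laplace-cong : ∀ {n} (G : Graph n) {z z′ : Vector n} → z ≗ z′ → laplace G z ≗ laplace G z′
laplace-cong G z≗z′ i = sumℚ-cong (λ j → cong₂ (λ a b → a - b when adj G i j) (z≗z′ i) (z≗z′ j))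

ℕ→ℚ-deg-* : ∀ {n} (G : Graph n) i x → ℕ→ℚ (deg G i) * x ≡ sumℚ (λ j → x when adj G i j)
ℕ→ℚ-deg-* G i x = begin
  ℕ→ℚ (deg G i) * x                      ≡⟨ cong (_* x) (sumℕ→ℚ (ind ∘ adj G i)) ⟩
  sumℚ (ℕ→ℚ ∘ ind ∘ adj G i) * x         ≡⟨ *-comm (sumℚ (ℕ→ℚ ∘ ind ∘ adj G i)) x ⟩
  x * sumℚ (ℕ→ℚ ∘ ind ∘ adj G i)         ≡⟨ sym (sumℚ-*ˡ x (ℕ→ℚ ∘ ind ∘ adj G i)) ⟩
  sumℚ (λ j → x * ℕ→ℚ (ind (adj G i j))) ≡⟨ sumℚ-cong (λ j → scale (adj G i j)) ⟩
  sumℚ (λ j → x when adj G i j)          ∎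
  where
  open ≡-Reasoning
  ind : Bool → ℕ
  ind b = if b then 1 else 0
  scale : ∀ b → x * ℕ→ℚ (ind b) ≡ x when b
  scale false = *-zeroʳ x
  scale true  = *-identityʳ x

Laplacian-entry : ∀ {n} (G : Graph n) (z : Vector n) i j →
  Laplacian G i j * z j ≡ (ℕ→ℚ (deg G i) * z i when ⌊ i ≟ j ⌋) + (- z j when adj G i j)
Laplacian-entry G z i j with i ≟ j
... | yes refl rewrite irrefl G i = sym (+-identityʳ _)
... | no _ with adj G i j
...   | true  = trans (sym (neg-distribˡ-* 1ℚ (z j)))
                      (trans (cong -_ (*-identityˡ (z j))) (sym (+-identityˡ _)))
...   | false = trans (*-zeroˡ (z j)) (sym (+-identityˡ 0ℚ))

Laplacian-apply : ∀ {n} (G : Graph n) (z : Vector n) i →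
  sumℚ (λ j → Laplacian G i j * z j) ≡ laplace G z i
Laplacian-apply G z i = begin
  sumℚ (λ j → Laplacian G i j * z j)
    ≡⟨ sumℚ-cong (Laplacian-entry G z i) ⟩
  sumℚ (λ j → (ℕ→ℚ (deg G i) * z i when ⌊ i ≟ j ⌋) + (- z j when adj G i j))
    ≡⟨ sumℚ-+ (λ j → ℕ→ℚ (deg G i) * z i when ⌊ i ≟ j ⌋) (λ j → - z j when adj G i j) ⟩
  sumℚ (λ j → ℕ→ℚ (deg G i) * z i when ⌊ i ≟ j ⌋) + sumℚ (λ j → - z j when adj G i j)
    ≡⟨ cong (_+ sumℚ (λ j → - z j when adj G i j)) (trans (sumℚ-δ i _) (ℕ→ℚ-deg-* G i (z i))) ⟩
  sumℚ (λ j → z i when adj G i j) + sumℚ (λ j → - z j when adj G i j)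
    ≡⟨ sym (sumℚ-+ (λ j → z i when adj G i j) (λ j → - z j when adj G i j)) ⟩
  sumℚ (λ j → (z i when adj G i j) + (- z j when adj G i j))
    ≡⟨ sumℚ-cong (λ j → when-+ (adj G i j) (z i) (- z j)) ⟩
  laplace G z i ∎
  where open ≡-Reasoning

In1Eigenspace-Laplacian : ∀ {n} (G : Graph n) (z : Vector n) →
  In1Eigenspace (Laplacian G) z ⇔ laplace G z ≗ z
In1Eigenspace-Laplacian G z = mk⇔
  (λ eig i → trans (sym (Laplacian-apply G z i)) (eig i))
  (λ eig i → trans (Laplacian-apply G z i) (eig i))

laplace-Leaf : ∀ {n} (G : Graph n) (z : Vector n) {u v} → Leaf G u v → laplace G z u ≡ z u - z v
laplace-Leaf G z {u} {v} u-leaf =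
  trans (sumℚ-cong (λ j → cong (z u - z j when_) (neighbours u-leaf j))) (sumℚ-δ v (λ j → z u - z j))

Leaf-eigen⇔ : ∀ {n} (G : Graph n) (z : Vector n) {u v} → Leaf G u v →
  (laplace G z u ≡ z u) ⇔ (z v ≡ 0ℚ)
Leaf-eigen⇔ G z {u} {v} u-leaf = mk⇔
  (λ eig → x-y≡x⇒y≡0 (trans (sym (laplace-Leaf G z u-leaf)) eig))
  (λ zv≡0 → trans (laplace-Leaf G z u-leaf) (trans (cong (λ t → z u - t) zv≡0) (+-identityʳ (z u))))
  where
  x-y≡x⇒y≡0 : ∀ {x y} → x - y ≡ x → y ≡ 0ℚ
  x-y≡x⇒y≡0 {x} {y} eq = begin
    y             ≡⟨ solve 2 (λ x y → y := x :- (x :- y)) refl x y ⟩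
    x - (x - y)   ≡⟨ cong (λ t → x - t) eq ⟩
    x - x         ≡⟨ +-inverseʳ x ⟩
    0ℚ            ∎
    where open ≡-Reasoning

sumℚ-*-zero : ∀ {k} (c : Fin k → ℚ) → sumℚ (λ t → c t * 0ℚ) ≡ 0ℚ
sumℚ-*-zero {k} c = trans (sumℚ-cong (λ t → *-zeroʳ (c t))) (sumℚ-zero k)

sumℚ-*-+ : ∀ {k} (c a b : Fin k → ℚ) →
  sumℚ (λ t → c t * (a t + b t)) ≡ sumℚ (λ t → c t * a t) + sumℚ (λ t → c t * b t)
sumℚ-*-+ c a b =
  trans (sumℚ-cong (λ t → *-distribˡ-+ (c t) (a t) (b t))) (sumℚ-+ (λ t → c t * a t) (λ t → c t * b t))

sumℚ-*-neg : ∀ {k} (c a : Fin k → ℚ) → sumℚ (λ t → c t * - a t) ≡ - sumℚ (λ t → c t * a t)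
sumℚ-*-neg c a = trans (sumℚ-cong (λ t → sym (neg-distribʳ-* (c t) (a t)))) (sumℚ-neg (λ t → c t * a t))

sumℚ-*-when : ∀ {k} (c a : Fin k → ℚ) b →
  sumℚ (λ t → c t * (a t when b)) ≡ (sumℚ (λ t → c t * a t) when b)
sumℚ-*-when c a true  = refl
sumℚ-*-when c a false = sumℚ-*-zero c

combination : ∀ {n k} → (Fin k → ℚ) → (Fin k → Vector n) → Vector n
combination c vs i = sumℚ (λ t → c t * vs t i)

Linear : ∀ {n n′} → (Vector n → Vector n′) → Set
Linear f = ∀ {k} (c : Fin k → ℚ) vs → f (combination c vs) ≗ combination c (λ t → f (vs t))

PreservesZero : ∀ {n n′} → (Vector n → Vector n′) → Set
PreservesZero f = ∀ z → z ≗ const 0ℚ → f z ≗ const 0ℚ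

LinIndep-image : ∀ {n n′ k} {f : Vector n → Vector n′} {g : Vector n′ → Vector n}
  {vs : Fin k → Vector n} →
  Linear g → PreservesZero g → (∀ t → g (f (vs t)) ≗ vs t) → LinIndep vs → LinIndep (λ t → f (vs t))
LinIndep-image {f = f} {g} {vs} g-linear g-zero g∘f≗id indep c c·fvs≗0 = indep c (λ i → begin
  combination c vs i                          ≡⟨ sumℚ-cong (λ t → cong (c t *_) (sym (g∘f≗id t i))) ⟩
  combination c (λ t → g (f (vs t))) i        ≡⟨ sym (g-linear c (λ t → f (vs t)) i) ⟩
  g (combination c (λ t → f (vs t))) i        ≡⟨ g-zero _ c·fvs≗0 i ⟩
  0ℚ                                          ∎)
  where open ≡-Reasoning

record EigenspaceIso {n n′} (M : Fin n → Fin n → ℚ) (M′ : Fin n′ → Fin n′ → ℚ) : Set where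
  field
    to          : Vector n → Vector n′
    from        : Vector n′ → Vector n
    to-eigen    : ∀ {z} → In1Eigenspace M z → In1Eigenspace M′ (to z)
    from-eigen  : ∀ {z} → In1Eigenspace M′ z → In1Eigenspace M (from z)
    from∘to     : ∀ {z} → In1Eigenspace M z → from (to z) ≗ z
    to∘from     : ∀ {z} → In1Eigenspace M′ z → to (from z) ≗ z
    to-linear   : Linear to
    from-linear : Linear from
    to-zero     : PreservesZero to
    from-zero   : PreservesZero from

EigenspaceIso-sym : ∀ {n n′} {M : Fin n → Fin n → ℚ} {M′ : Fin n′ → Fin n′ → ℚ} →
  EigenspaceIso M M′ → EigenspaceIso M′ M
EigenspaceIso-sym iso = record
  { to = from ; from = to ; to-eigen = from-eigen ; from-eigen = to-eigen
  ; from∘to = to∘from ; to∘from = from∘to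
  ; to-linear = from-linear ; from-linear = to-linear ; to-zero = from-zero ; from-zero = to-zero }
  where open EigenspaceIso iso

Mult1-transport : ∀ {n n′ m} {M : Fin n → Fin n → ℚ} {M′ : Fin n′ → Fin n′ → ℚ} →
  EigenspaceIso M M′ → Mult1 M m → Mult1 M′ m
Mult1-transport iso ((vs , eigen , indep) , maximal) =
  ( (λ t → to (vs t)) , (λ t → to-eigen (eigen t))
  , LinIndep-image {f = to} from-linear from-zero (λ t → from∘to (eigen t)) indep )
  , λ ws eigen′ indep′ → maximal (λ t → from (ws t)) (λ t → from-eigen (eigen′ t))
      (LinIndep-image {f = from} to-linear to-zero (λ t → to∘from (eigen′ t)) indep′)
  where open EigenspaceIso iso

pattern xΓ    = zero
pattern yΓ    = suc zero
pattern old i = suc (suc i)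

isVW-≢ : ∀ {n} {v w i : Fin n} j → i ≢ v → i ≢ w → isVW v w i j ≡ false
isVW-≢ j i≢v i≢w rewrite ⌊≟⌋-≢ i≢v | ⌊≟⌋-≢ i≢w = refl

isVW-at-v : ∀ {n} {v w : Fin n} j → v ≢ w → isVW v w v j ≡ ⌊ j ≟ w ⌋
isVW-at-v {v = v} j v≢w rewrite ⌊≟⌋-refl v | ⌊≟⌋-≢ v≢w = ∨-identityʳ _

isVW-at-w : ∀ {n} {v w : Fin n} j → v ≢ w → isVW v w w j ≡ ⌊ j ≟ v ⌋
isVW-at-w {w = w} j v≢w rewrite ⌊≟⌋-≢ (λ w≡v → v≢w (sym w≡v)) | ⌊≟⌋-refl w = refl

laplace-Γ-old : ∀ {n} (G : Graph n) v w (z′ : Vector (2 +ℕ n)) i →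
  laplace (Γ G v w) z′ (old i)
    ≡ (z′ (old i) - z′ yΓ when ⌊ i ≟ w ⌋)
      + sumℚ (λ j → z′ (old i) - z′ (old j) when adj G i j ∧ not (isVW v w i j))
laplace-Γ-old G v w z′ i = +-identityˡ _

laplace-Γ-y : ∀ {n} (G : Graph n) v w (z′ : Vector (2 +ℕ n)) →
  laplace (Γ G v w) z′ yΓ ≡ (z′ yΓ - z′ xΓ) + (z′ yΓ - z′ (old w))
laplace-Γ-y G v w z′ =
  cong ((z′ yΓ - z′ xΓ) +_) (trans (+-identityˡ _) (sumℚ-δ′ w (λ j → z′ yΓ - z′ (old j))))

Leaf-Γ-x : ∀ {n} (G : Graph n) v w → Leaf (Γ G v w) xΓ yΓ
Leaf-Γ-x G v w = leaf λ where
  xΓ      → refl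
  yΓ      → refl
  (old j) → refl

Leaf-Γ-old : ∀ {n} (G : Graph n) {u v w} → Leaf G u v → u ≢ v → u ≢ w →
  Leaf (Γ G v w) (old u) (old v)
Leaf-Γ-old G {u} {v} {w} u-leaf u≢v u≢w = leaf neighbours-u
  where
  neighbours-u : ∀ j → adjΓ G v w (old u) j ≡ ⌊ old v ≟ j ⌋
  neighbours-u xΓ      = refl
  neighbours-u yΓ      = ⌊≟⌋-≢ u≢w
  neighbours-u (old j) rewrite isVW-≢ j u≢v u≢w = begin
    adj G u j ∧ true    ≡⟨ ∧-identityʳ (adj G u j) ⟩
    adj G u j           ≡⟨ neighbours u-leaf j ⟩
    ⌊ v ≟ j ⌋           ≡⟨ sym (⌊≟⌋-suc v j) ⟩
    ⌊ suc v ≟ suc j ⌋   ≡⟨ sym (⌊≟⌋-suc (suc v) (suc j)) ⟩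
    ⌊ old v ≟ old j ⌋   ∎
    where open ≡-Reasoning

module EigenspaceCorrespondence {n} (G : Graph n) {u v w : Fin n}
  (u-leaf : Leaf G u v) (v~w : adj G v w ≡ true) (w≢u : w ≢ u) where

  Γ′ : Graph (2 +ℕ n)
  Γ′ = Γ G v w

  u~v : adj G u v ≡ true
  u~v = trans (neighbours u-leaf v) (⌊≟⌋-refl v)

  v~u : adj G v u ≡ true
  v~u = trans (adj-sym G v u) u~v

  w~v : adj G w v ≡ true
  w~v = trans (adj-sym G w v) v~w

  u≢v : u ≢ v
  u≢v = adj⇒≢ G u~v

  v≢u : v ≢ u
  v≢u = adj⇒≢ G v~u

  v≢w : v ≢ w
  v≢w = adj⇒≢ G v~w

  w≢v : w ≢ v
  w≢v = adj⇒≢ G w~v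

  u≢w : u ≢ w
  u≢w u≡w = w≢u (sym u≡w)

  φ : Vector n → Vector (2 +ℕ n)
  φ z xΓ      = - z w
  φ z yΓ      = 0ℚ
  φ z (old j) = z j + (z w when ⌊ j ≟ u ⌋)

  ψ : Vector (2 +ℕ n) → Vector n
  ψ z′ j = z′ (old j) - (z′ (old w) when ⌊ j ≟ u ⌋)

  φ-old-≢u : ∀ (z : Vector n) {j} → j ≢ u → φ z (old j) ≡ z j
  φ-old-≢u z {j} j≢u = trans (cong (λ b → z j + (z w when b)) (⌊≟⌋-≢ j≢u)) (+-identityʳ (z j))

  neighbour-≢u : ∀ {i j} → i ≢ v → adj G i j ≡ true → j ≢ u
  neighbour-≢u i≢v i~j refl = i≢v (Leaf⇒neighbour G u-leaf i~j)

  φ-laplace-away : ∀ (z : Vector n) {i} → i ≢ u → i ≢ v →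
    sumℚ (λ j → φ z (old i) - φ z (old j) when adj G i j) ≡ laplace G z i
  φ-laplace-away z {i} i≢u i≢v = sumℚ-cong agree
    where
    agree : ∀ j → (φ z (old i) - φ z (old j) when adj G i j) ≡ (z i - z j when adj G i j)
    agree j = when-cong (λ i~j → cong₂ _-_ (φ-old-≢u z i≢u) (φ-old-≢u z (neighbour-≢u i≢v i~j)))

  φ-laplace-v : ∀ (z : Vector n) →
    sumℚ (λ j → φ z (old v) - φ z (old j) when adj G v j) ≡ laplace G z v - z w
  φ-laplace-v z = begin
    sumℚ (λ j → φ z (old v) - φ z (old j) when adj G v j)
      ≡⟨ sumℚ-cong bumped-at-u ⟩
    sumℚ (λ j → (z v - z j when adj G v j) + (- z w when ⌊ j ≟ u ⌋))
      ≡⟨ sumℚ-+ (λ j → z v - z j when adj G v j) _ ⟩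
    laplace G z v + sumℚ (λ j → - z w when ⌊ j ≟ u ⌋)
      ≡⟨ cong (laplace G z v +_) (sumℚ-δ′ u (λ _ → - z w)) ⟩
    laplace G z v - z w ∎
    where
    open ≡-Reasoning
    bumped-at-u : ∀ j → (φ z (old v) - φ z (old j) when adj G v j)
                        ≡ (z v - z j when adj G v j) + (- z w when ⌊ j ≟ u ⌋)
    bumped-at-u j with j ≟ u
    ... | yes refl rewrite v~u | φ-old-≢u z v≢u =
          solve 3 (λ a b c → a :- (b :+ c) := (a :- b) :+ (:- c)) refl (z v) (z j) (z w)
    ... | no _ = trans (when-cong (λ _ → cong₂ _-_ (φ-old-≢u z v≢u) (+-identityʳ (z j))))
                       (sym (+-identityʳ _))

  φ-row-v : ∀ (z : Vector n) → laplace Γ′ (φ z) (old v) ≡ laplace G z v - z v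
  φ-row-v z = begin
    laplace Γ′ (φ z) (old v)
      ≡⟨ laplace-Γ-old G v w (φ z) v ⟩
    (φ z (old v) - 0ℚ when ⌊ v ≟ w ⌋)
      + sumℚ (λ j → φ z (old v) - φ z (old j) when adj G v j ∧ not (isVW v w v j))
      ≡⟨ cong₂ _+_ (cong (φ z (old v) - 0ℚ when_) (⌊≟⌋-≢ v≢w))
                    (sumℚ-cong (λ j → cong (λ b → φ z (old v) - φ z (old j) when adj G v j ∧ not b)
                                           (isVW-at-v j v≢w))) ⟩
    0ℚ + sumℚ (λ j → φ z (old v) - φ z (old j) when adj G v j ∧ not ⌊ j ≟ w ⌋)
      ≡⟨ trans (+-identityˡ _) (sumℚ-when-∧-not (adj G v) (λ j → φ z (old v) - φ z (old j)) v~w) ⟩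
    sumℚ (λ j → φ z (old v) - φ z (old j) when adj G v j) - (φ z (old v) - φ z (old w))
      ≡⟨ cong₂ _-_ (φ-laplace-v z) (cong₂ _-_ (φ-old-≢u z v≢u) (φ-old-≢u z w≢u)) ⟩
    (laplace G z v - z w) - (z v - z w)
      ≡⟨ solve 3 (λ l a b → (l :- b) :- (a :- b) := l :- a) refl (laplace G z v) (z v) (z w) ⟩
    laplace G z v - z v ∎
    where open ≡-Reasoning

  φ-row-w : ∀ (z : Vector n) → laplace Γ′ (φ z) (old w) ≡ laplace G z w + z v
  φ-row-w z = begin
    laplace Γ′ (φ z) (old w)
      ≡⟨ laplace-Γ-old G v w (φ z) w ⟩
    (φ z (old w) - 0ℚ when ⌊ w ≟ w ⌋)
      + sumℚ (λ j → φ z (old w) - φ z (old j) when adj G w j ∧ not (isVW v w w j))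
      ≡⟨ cong₂ _+_ (cong (φ z (old w) - 0ℚ when_) (⌊≟⌋-refl w))
                    (sumℚ-cong (λ j → cong (λ b → φ z (old w) - φ z (old j) when adj G w j ∧ not b)
                                           (isVW-at-w j v≢w))) ⟩
    (φ z (old w) - 0ℚ) + sumℚ (λ j → φ z (old w) - φ z (old j) when adj G w j ∧ not ⌊ j ≟ v ⌋)
      ≡⟨ cong ((φ z (old w) - 0ℚ) +_) (sumℚ-when-∧-not (adj G w) (λ j → φ z (old w) - φ z (old j)) w~v) ⟩
    (φ z (old w) - 0ℚ)
      + (sumℚ (λ j → φ z (old w) - φ z (old j) when adj G w j) - (φ z (old w) - φ z (old v)))
      ≡⟨ cong₂ (λ a l → (a - 0ℚ) + (l - (a - φ z (old v)))) (φ-old-≢u z w≢u) (φ-laplace-away z w≢u w≢v) ⟩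
    (z w - 0ℚ) + (laplace G z w - (z w - φ z (old v)))
      ≡⟨ cong (λ b → (z w - 0ℚ) + (laplace G z w - (z w - b))) (φ-old-≢u z v≢u) ⟩
    (z w - 0ℚ) + (laplace G z w - (z w - z v))
      ≡⟨ solve 3 (λ a l b → (a :- con 0ℚ) :+ (l :- (a :- b)) := l :+ b) refl
                 (z w) (laplace G z w) (z v) ⟩
    laplace G z w + z v ∎
    where open ≡-Reasoning

  φ-row-other : ∀ (z : Vector n) {i} → i ≢ u → i ≢ v → i ≢ w →
    laplace Γ′ (φ z) (old i) ≡ laplace G z i
  φ-row-other z {i} i≢u i≢v i≢w = begin
    laplace Γ′ (φ z) (old i)
      ≡⟨ laplace-Γ-old G v w (φ z) i ⟩
    (φ z (old i) - 0ℚ when ⌊ i ≟ w ⌋)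
      + sumℚ (λ j → φ z (old i) - φ z (old j) when adj G i j ∧ not (isVW v w i j))
      ≡⟨ cong₂ _+_ (cong (φ z (old i) - 0ℚ when_) (⌊≟⌋-≢ i≢w))
                   (sumℚ-cong (λ j → cong (φ z (old i) - φ z (old j) when_)
                     (trans (cong (λ b → adj G i j ∧ not b) (isVW-≢ j i≢v i≢w)) (∧-identityʳ _)))) ⟩
    0ℚ + sumℚ (λ j → φ z (old i) - φ z (old j) when adj G i j)
      ≡⟨ trans (+-identityˡ _) (φ-laplace-away z i≢u i≢v) ⟩
    laplace G z i ∎
    where open ≡-Reasoning

  Leaf-Γ-u : Leaf Γ′ (old u) (old v)
  Leaf-Γ-u = Leaf-Γ-old G u-leaf u≢v u≢w

  φ-row-≢u : ∀ (z : Vector n) → z v ≡ 0ℚ → ∀ {i} → i ≢ u →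
    laplace Γ′ (φ z) (old i) ≡ laplace G z i
  φ-row-≢u z zv≡0 {i} i≢u = by-cases (i ≟ v) (i ≟ w)
    where
    Row : Fin n → Set
    Row k = laplace Γ′ (φ z) (old k) ≡ laplace G z k
    by-cases : Dec (i ≡ v) → Dec (i ≡ w) → Row i
    by-cases (yes i≡v) _ = subst Row (sym i≡v)
      (trans (φ-row-v z) (trans (cong (λ t → laplace G z v - t) zv≡0) (+-identityʳ _)))
    by-cases (no _) (yes i≡w) = subst Row (sym i≡w)
      (trans (φ-row-w z) (trans (cong (laplace G z w +_) zv≡0) (+-identityʳ _)))
    by-cases (no i≢v) (no i≢w) = φ-row-other z i≢u i≢v i≢w

  φ-eigen⇒zv≡0 : ∀ (z : Vector n) → laplace Γ′ (φ z) ≗ φ z → z v ≡ 0ℚ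
  φ-eigen⇒zv≡0 z eig′ =
    trans (sym (φ-old-≢u z v≢u)) (Equivalence.to (Leaf-eigen⇔ Γ′ (φ z) Leaf-Γ-u) (eig′ (old u)))

  φ-eigen⇔ : ∀ (z : Vector n) → (laplace G z ≗ z) ⇔ (laplace Γ′ (φ z) ≗ φ z)
  φ-eigen⇔ z = mk⇔ forward backward
    where
    forward : laplace G z ≗ z → laplace Γ′ (φ z) ≗ φ z
    forward eig xΓ = Equivalence.from (Leaf-eigen⇔ Γ′ (φ z) (Leaf-Γ-x G v w)) refl
    forward eig yΓ = trans (laplace-Γ-y G v w (φ z))
      (trans (cong (λ t → (0ℚ - - z w) + (0ℚ - t)) (φ-old-≢u z w≢u))
             (solve 1 (λ a → (con 0ℚ :- (:- a)) :+ (con 0ℚ :- a) := con 0ℚ) refl (z w)))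
    forward eig (old i) = Fin-split (λ k → laplace Γ′ (φ z) (old k) ≡ φ z (old k)) u
      (Equivalence.from (Leaf-eigen⇔ Γ′ (φ z) Leaf-Γ-u) (trans (φ-old-≢u z v≢u) zv≡0))
      (λ i≢u → trans (φ-row-≢u z zv≡0 i≢u) (trans (eig _) (sym (φ-old-≢u z i≢u))))
      i
      where
      zv≡0 : z v ≡ 0ℚ
      zv≡0 = Equivalence.to (Leaf-eigen⇔ G z u-leaf) (eig u)
    backward : laplace Γ′ (φ z) ≗ φ z → laplace G z ≗ z
    backward eig′ = Fin-split (λ k → laplace G z k ≡ z k) u
      (Equivalence.from (Leaf-eigen⇔ G z u-leaf) zv≡0)
      (λ i≢u → trans (sym (φ-row-≢u z zv≡0 i≢u)) (trans (eig′ (old _)) (φ-old-≢u z i≢u)))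
      where
      zv≡0 : z v ≡ 0ℚ
      zv≡0 = φ-eigen⇒zv≡0 z eig′

  ψ-w : ∀ (z′ : Vector (2 +ℕ n)) → ψ z′ w ≡ z′ (old w)
  ψ-w z′ = trans (cong (λ b → z′ (old w) - (z′ (old w) when b)) (⌊≟⌋-≢ w≢u)) (+-identityʳ _)

  ψ∘φ : ∀ (z : Vector n) → ψ (φ z) ≗ z
  ψ∘φ z j = trans (cong (λ t → φ z (old j) - (t when ⌊ j ≟ u ⌋)) (φ-old-≢u z w≢u))
    (solve 2 (λ a c → a :+ c :- c := a) refl (z j) (z w when ⌊ j ≟ u ⌋))

  φ∘ψ : ∀ (z′ : Vector (2 +ℕ n)) → laplace Γ′ z′ ≗ z′ → φ (ψ z′) ≗ z′
  φ∘ψ z′ eig xΓ = begin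
    - ψ z′ w
      ≡⟨ cong -_ (ψ-w z′) ⟩
    - z′ (old w)
      ≡⟨ solve 2 (λ a b → :- b := a :+ ((con 0ℚ :- a) :+ (con 0ℚ :- b))) refl (z′ xΓ) (z′ (old w)) ⟩
    z′ xΓ + ((0ℚ - z′ xΓ) + (0ℚ - z′ (old w)))
      ≡⟨ cong (z′ xΓ +_) y-row ⟩
    z′ xΓ + 0ℚ
      ≡⟨ +-identityʳ (z′ xΓ) ⟩
    z′ xΓ ∎
    where
    open ≡-Reasoning
    y≡0 : z′ yΓ ≡ 0ℚ
    y≡0 = Equivalence.to (Leaf-eigen⇔ Γ′ z′ (Leaf-Γ-x G v w)) (eig xΓ)
    y-row : (0ℚ - z′ xΓ) + (0ℚ - z′ (old w)) ≡ 0ℚ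
    y-row = subst (λ t → (t - z′ xΓ) + (t - z′ (old w)) ≡ t) y≡0
                  (trans (sym (laplace-Γ-y G v w z′)) (eig yΓ))
  φ∘ψ z′ eig yΓ = sym (Equivalence.to (Leaf-eigen⇔ Γ′ z′ (Leaf-Γ-x G v w)) (eig xΓ))
  φ∘ψ z′ eig (old j) = trans (cong (λ t → ψ z′ j + (t when ⌊ j ≟ u ⌋)) (ψ-w z′))
    (solve 2 (λ a c → a :- c :+ c := a) refl (z′ (old j)) (z′ (old w) when ⌊ j ≟ u ⌋))

  ψ-eigen : ∀ (z′ : Vector (2 +ℕ n)) → laplace Γ′ z′ ≗ z′ → laplace G (ψ z′) ≗ ψ z′
  ψ-eigen z′ eig = Equivalence.from (φ-eigen⇔ (ψ z′)) (λ i →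
    trans (laplace-cong Γ′ (φ∘ψ z′ eig) i) (trans (eig i) (sym (φ∘ψ z′ eig i))))

  φ-linear : Linear φ
  φ-linear c vs xΓ      = sym (sumℚ-*-neg c (λ t → vs t w))
  φ-linear c vs yΓ      = sym (sumℚ-*-zero c)
  φ-linear c vs (old j) = sym (trans (sumℚ-*-+ c (λ t → vs t j) (λ t → vs t w when ⌊ j ≟ u ⌋))
    (cong (combination c vs j +_) (sumℚ-*-when c (λ t → vs t w) ⌊ j ≟ u ⌋)))

  ψ-linear : Linear ψ
  ψ-linear c vs j = sym (trans
    (sumℚ-*-+ c (λ t → vs t (old j)) (λ t → - (vs t (old w) when ⌊ j ≟ u ⌋)))
    (cong (combination c vs (old j) +_)
      (trans (sumℚ-*-neg c (λ t → vs t (old w) when ⌊ j ≟ u ⌋))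
             (cong -_ (sumℚ-*-when c (λ t → vs t (old w)) ⌊ j ≟ u ⌋)))))

  φ-zero : PreservesZero φ
  φ-zero z z≗0 xΓ      = cong -_ (z≗0 w)
  φ-zero z z≗0 yΓ      = refl
  φ-zero z z≗0 (old j) =
    trans (cong₂ (λ a b → a + (b when ⌊ j ≟ u ⌋)) (z≗0 j) (z≗0 w))
          (trans (+-identityˡ _) (0ℚ-when ⌊ j ≟ u ⌋))

  ψ-zero : PreservesZero ψ
  ψ-zero z′ z′≗0 j =
    trans (cong₂ (λ a b → a - (b when ⌊ j ≟ u ⌋)) (z′≗0 (old j)) (z′≗0 (old w)))
          (cong (λ t → 0ℚ - t) (0ℚ-when ⌊ j ≟ u ⌋))

  iso : EigenspaceIso (Laplacian G) (Laplacian Γ′)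
  iso = record
    { to          = φ
    ; from        = ψ
    ; to-eigen    = λ {z} eig → Equivalence.from (In1Eigenspace-Laplacian Γ′ (φ z))
                      (Equivalence.to (φ-eigen⇔ z) (Equivalence.to (In1Eigenspace-Laplacian G z) eig))
    ; from-eigen  = λ {z′} eig → Equivalence.from (In1Eigenspace-Laplacian G (ψ z′))
                      (ψ-eigen z′ (Equivalence.to (In1Eigenspace-Laplacian Γ′ z′) eig))
    ; from∘to     = λ {z} _ → ψ∘φ z
    ; to∘from     = λ {z′} eig → φ∘ψ z′ (Equivalence.to (In1Eigenspace-Laplacian Γ′ z′) eig)
    ; to-linear   = φ-linear
    ; from-linear = ψ-linear
    ; to-zero     = φ-zero
    ; from-zero   = ψ-zero
    }

lemma2p4 : ∀ {n} (G : Graph n) (u v w : Fin n) →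
    deg G u ≡ 1 → adj G u v ≡ true → deg G v ≥ 3 →
    adj G v w ≡ true → w ≢ u →
    ∀ (m : ℕ) → Mult1 (Laplacian G) m ⇔ Mult1 (Laplacian (Γ G v w)) m
lemma2p4 G u v w deg≡1 u~v _ v~w w≢u m =
  mk⇔ (Mult1-transport iso) (Mult1-transport (EigenspaceIso-sym iso))
  where
  iso : EigenspaceIso (Laplacian G) (Laplacian (Γ G v w))
  iso = EigenspaceCorrespondence.iso G (deg≡1⇒Leaf G deg≡1 u~v) v~w w≢u
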